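{- Let $F$ be a field of characteristic $0$, let $Z\in\operatorname{SL}_2(F)$ with $\operatorname{Tr}Z=t\neq\pm2$, and let $(x_1,x_2,x_3)\in F^3$ satisfy $x_1^2+x_2^2+x_3^2-x_1x_2x_3=t+2$. Suppose $\Delta=t+2-x_2^2\neq0$. Then for any $Y\in\operatorname{SL}_2(F)$ with $\operatorname{Tr}(ZY)=\operatorname{Tr}Y=x_2$, there exists a unique $X\in\operatorname{SL}_2(F)$ such that (i) $\operatorname{Tr}X=x_1$, (ii) $\operatorname{Tr}(XY)=x_3$, and (iii) $XYX^{ -1}Y^{ -1}=Z$. The same conclusion holds with $F$ replaced by a (commutative) ring $D$ (all of $Z,Y,X,x_i,t$ taken over $D$), provided $\Delta$ is a unit in $D$. -}

module Defs where

open import Level using (_⊔_)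
open import Data.Nat using (ℕ; suc)
open import Data.Product using (Σ; _×_)
open import Relation.Nullary using (¬_)
open import Algebra.Bundles using (CommutativeRing)
import Algebra.Bundles
import Algebra.Definitions.RawSemiring as RS

module Mat2 {c ℓ} (R : CommutativeRing c ℓ) where
  open CommutativeRing R

  record M2 : Set c where
    constructor mat
    field
      a b c' d : Carrier
  open M2 public

  infixl 7 _·_
  _·_ : M2 → M2 → M2
  mat a₁ b₁ c₁ d₁ · mat a₂ b₂ c₂ d₂ =
    mat (a₁ * a₂ + b₁ * c₂) (a₁ * b₂ + b₁ * d₂)
        (c₁ * a₂ + d₁ * c₂) (c₁ * b₂ + d₁ * d₂)

  tr : M2 → Carrier
  tr (mat a₁ _ _ d₁) = a₁ + d₁

  det : M2 → Carrier
  det (mat a₁ b₁ c₁ d₁) = a₁ * d₁ - b₁ * c₁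

  -- adjugate; for X ∈ SL₂ (det X ≈ 1) this is the inverse X⁻¹
  inv : M2 → M2
  inv (mat a₁ b₁ c₁ d₁) = mat d₁ (- b₁) (- c₁) a₁

  infix 4 _≈M_
  _≈M_ : M2 → M2 → Set ℓ
  mat a₁ b₁ c₁ d₁ ≈M mat a₂ b₂ c₂ d₂ =
    (a₁ ≈ a₂) × (b₁ ≈ b₂) × (c₁ ≈ c₂) × (d₁ ≈ d₂)

  InSL2 : M2 → Set ℓ
  InSL2 X = det X ≈ 1#

IsField : ∀ {c ℓ} → CommutativeRing c ℓ → Set (c ⊔ ℓ)
IsField R = ¬ (1# ≈ 0#) × (∀ x → ¬ (x ≈ 0#) → Σ Carrier λ y → x * y ≈ 1#)
  where open CommutativeRing R

CharZero : ∀ {c ℓ} → CommutativeRing c ℓ → Set ℓ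
CharZero R = ∀ (n : ℕ) → ¬ (R._≈_ (M._×_ (suc n) R.1#) R.0#)
  where
  module R = CommutativeRing R
  module M = RS (Algebra.Bundles.Semiring.rawSemiring R.semiring)

IsUnit : ∀ {c ℓ} (R : CommutativeRing c ℓ) → CommutativeRing.Carrier R → Set (c ⊔ ℓ)
IsUnit R x = Σ Carrier λ y → x * y ≈ 1#
  where open CommutativeRing R

{-# OPTIONS --safe #-}
-- Put W = Z Y. Then X Y X⁻¹ Y⁻¹ = Z says X Y = W X, and W, Y both have trace x₂ and determinant 1.
-- By Cayley–Hamilton X₀ = W + Y − x₂ satisfies X₀ Y = W X₀, with det X₀ = Δ, tr X₀ = 0 and
-- tr (X₀ Y) = − Δ. If P Y = W P then, by the polarised Cayley–Hamilton identity, adj(X₀) P is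
-- (x₂ tr P − tr (P Y)) − (tr P) Y, so P = Δ⁻¹ X₀ adj(X₀) P is determined by its two traces when Δ is
-- a unit. Conversely X₀ (α + β Y) intertwines for all α, β; the traces fix α and β, and the
-- determinant is then 1 exactly by the Fricke relation x₁² + x₂² + x₃² − x₁x₂x₃ = t + 2.
module Submission where

open import Defs
open import Data.Product using (Σ; _×_; _,_)
open import Relation.Nullary using (¬_)
open import Algebra.Bundles using (CommutativeRing)
open import Data.Nat.Base as ℕ using (ℕ; zero; suc)
import Data.Nat.Properties as ℕ
open import Data.Integer.Base as ℤ using (ℤ; +_; -[1+_])
import Data.Integer.Properties as ℤ
open import Data.Sign.Base as Sign using (Sign)
open import Data.Maybe.Base using (Maybe; just; nothing)
open import Data.Fin using (#_)
open import Data.Vec.Base using (Vec; []; _∷_)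
open import Relation.Nullary.Decidable using (yes; no)
open import Relation.Binary.Bundles using (Setoid)
import Relation.Binary.PropositionalEquality as ≡
import Relation.Binary.Reasoning.Setoid as SetoidReasoning
open import Algebra.Solver.Ring.AlmostCommutativeRing
  using (fromCommutativeRing; _-Raw-AlmostCommutative⟶_)

module IntegerCoefficientSolver {c ℓ} (R : CommutativeRing c ℓ) where
  open CommutativeRing R
  open import Algebra.Properties.Ring ring using (-0#≈0#; -‿involutive; -1*x≈-x; -‿+-comm)
  open import Algebra.Properties.Semiring.Mult.TCOptimised semiring using (1+×; ×-homo-+; ×1-homo-*) renaming (_×_ to _×ℕ_)
  open import Algebra.Properties.CommutativeSemigroup +-commutativeSemigroup using () renaming (interchange to +-interchange)
  open import Algebra.Properties.CommutativeSemigroup *-commutativeSemigroup using () renaming (interchange to *-interchange)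
  open SetoidReasoning setoid

  -- The optimised multiplication makes fromℕ 1 and fromℕ 2 reduce to 1# and 1# + 1#, so numerals
  -- in solver equations evaluate to the ring's own constants.
  fromℕ : ℕ → Carrier
  fromℕ n = n ×ℕ 1#

  fromℤ : ℤ → Carrier
  fromℤ (+ n)    = fromℕ n
  fromℤ -[1+ n ] = - fromℕ (suc n)

  fromℤ-⊖ : ∀ m n → fromℤ (m ℤ.⊖ n) ≈ fromℕ m - fromℕ n
  fromℤ-⊖ m       zero    = sym (trans (+-congˡ -0#≈0#) (+-identityʳ _))
  fromℤ-⊖ zero    (suc n) = sym (+-identityˡ _)
  fromℤ-⊖ (suc m) (suc n) = begin
    fromℤ (suc m ℤ.⊖ suc n)              ≡⟨ ≡.cong fromℤ (ℤ.[1+m]⊖[1+n]≡m⊖n m n) ⟩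
    fromℤ (m ℤ.⊖ n)                      ≈⟨ fromℤ-⊖ m n ⟩
    fromℕ m - fromℕ n                    ≈⟨ +-identityˡ _ ⟨
    0# + (fromℕ m - fromℕ n)             ≈⟨ +-congʳ (-‿inverseʳ 1#) ⟨
    (1# - 1#) + (fromℕ m - fromℕ n)      ≈⟨ +-interchange 1# (- 1#) (fromℕ m) (- fromℕ n) ⟩
    (1# + fromℕ m) + (- 1# - fromℕ n)    ≈⟨ +-cong (sym (1+× m 1#)) (-‿+-comm 1# (fromℕ n)) ⟩
    fromℕ (suc m) + - (1# + fromℕ n)     ≈⟨ +-congˡ (-‿cong (1+× n 1#)) ⟨
    fromℕ (suc m) - fromℕ (suc n)        ∎

  fromℤ-+ : ∀ i j → fromℤ (i ℤ.+ j) ≈ fromℤ i + fromℤ j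
  fromℤ-+ (+ m)    (+ n)    = ×-homo-+ 1# m n
  fromℤ-+ (+ m)    -[1+ n ] = fromℤ-⊖ m (suc n)
  fromℤ-+ -[1+ m ] (+ n)    = trans (fromℤ-⊖ n (suc m)) (+-comm _ _)
  fromℤ-+ -[1+ m ] -[1+ n ] = begin
    - fromℕ (suc (suc (m ℕ.+ n)))        ≡⟨ ≡.cong (λ k → - fromℕ (suc k)) (ℕ.+-suc m n) ⟨
    - fromℕ (suc m ℕ.+ suc n)            ≈⟨ -‿cong (×-homo-+ 1# (suc m) (suc n)) ⟩
    - (fromℕ (suc m) + fromℕ (suc n))    ≈⟨ -‿+-comm _ _ ⟨
    - fromℕ (suc m) - fromℕ (suc n)      ∎

  fromℤ-neg : ∀ i → fromℤ (ℤ.- i) ≈ - fromℤ i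
  fromℤ-neg (+ zero)  = sym -0#≈0#
  fromℤ-neg (+ suc n) = refl
  fromℤ-neg -[1+ n ]  = sym (-‿involutive _)

  fromSign : Sign → Carrier
  fromSign Sign.+ = 1#
  fromSign Sign.- = - 1#

  fromSign-* : ∀ s t → fromSign (s Sign.* t) ≈ fromSign s * fromSign t
  fromSign-* Sign.+ t      = sym (*-identityˡ _)
  fromSign-* Sign.- Sign.+ = sym (*-identityʳ _)
  fromSign-* Sign.- Sign.- = sym (trans (-1*x≈-x _) (-‿involutive _))

  fromℤ-◃ : ∀ s n → fromℤ (s ℤ.◃ n) ≈ fromSign s * fromℕ n
  fromℤ-◃ s      zero    = sym (zeroʳ _)
  fromℤ-◃ Sign.+ (suc n) = sym (*-identityˡ _)
  fromℤ-◃ Sign.- (suc n) = sym (-1*x≈-x _)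

  fromℤ-signAbs : ∀ i → fromℤ i ≈ fromSign (ℤ.sign i) * fromℕ ℤ.∣ i ∣
  fromℤ-signAbs i = begin
    fromℤ i                                ≡⟨ ≡.cong fromℤ (ℤ.◃-inverse i) ⟨
    fromℤ (ℤ.sign i ℤ.◃ ℤ.∣ i ∣)           ≈⟨ fromℤ-◃ (ℤ.sign i) ℤ.∣ i ∣ ⟩
    fromSign (ℤ.sign i) * fromℕ ℤ.∣ i ∣    ∎

  fromℤ-* : ∀ i j → fromℤ (i ℤ.* j) ≈ fromℤ i * fromℤ j
  fromℤ-* i j = begin
    fromℤ (i ℤ.* j)                                  ≈⟨ fromℤ-◃ (s Sign.* t) (m ℕ.* n) ⟩
    fromSign (s Sign.* t) * fromℕ (m ℕ.* n)          ≈⟨ *-cong (fromSign-* s t) (×1-homo-* m n) ⟩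
    (fromSign s * fromSign t) * (fromℕ m * fromℕ n)  ≈⟨ *-interchange _ _ _ _ ⟩
    (fromSign s * fromℕ m) * (fromSign t * fromℕ n)  ≈⟨ *-cong (fromℤ-signAbs i) (fromℤ-signAbs j) ⟨
    fromℤ i * fromℤ j                                ∎
    where s = ℤ.sign i; t = ℤ.sign j; m = ℤ.∣ i ∣; n = ℤ.∣ j ∣

  fromℤ-homomorphism : ℤ.+-*-rawRing -Raw-AlmostCommutative⟶ fromCommutativeRing R
  fromℤ-homomorphism = record
    { ⟦_⟧    = fromℤ
    ; +-homo = fromℤ-+
    ; *-homo = fromℤ-*
    ; -‿homo = fromℤ-neg
    ; 0-homo = refl
    ; 1-homo = refl
    }

  fromℤ-≟ : ∀ i j → Maybe (fromℤ i ≈ fromℤ j)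
  fromℤ-≟ i j with i ℤ.≟ j
  ... | yes i≡j = just (reflexive (≡.cong fromℤ i≡j))
  ... | no _    = nothing

  open import Algebra.Solver.Ring ℤ.+-*-rawRing (fromCommutativeRing R) fromℤ-homomorphism fromℤ-≟ public

module Matrices {c ℓ} (R : CommutativeRing c ℓ) where
  open CommutativeRing R
  open Mat2 R public
  open IntegerCoefficientSolver R
  open import Algebra.Properties.Ring ring using (x≈y⇒x∙y⁻¹≈ε)

  infixl 6 _⊕_ _⊖_
  infixr 7 _•_

  _⊕_ : M2 → M2 → M2
  mat a₁ b₁ c₁ d₁ ⊕ mat a₂ b₂ c₂ d₂ = mat (a₁ + a₂) (b₁ + b₂) (c₁ + c₂) (d₁ + d₂)

  _⊖_ : M2 → M2 → M2
  mat a₁ b₁ c₁ d₁ ⊖ mat a₂ b₂ c₂ d₂ = mat (a₁ - a₂) (b₁ - b₂) (c₁ - c₂) (d₁ - d₂)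

  _•_ : Carrier → M2 → M2
  u • mat a₁ b₁ c₁ d₁ = mat (u * a₁) (u * b₁) (u * c₁) (u * d₁)

  𝕀 : M2
  𝕀 = mat 1# 0# 0# 1#

  poly₁ : Carrier → Carrier → M2 → M2
  poly₁ s t Y = s • 𝕀 ⊕ t • Y

  intertwiner : M2 → M2 → Carrier → M2
  intertwiner W Y τ = W ⊕ Y ⊕ (- τ) • 𝕀

  ≈M-setoid : Setoid c ℓ
  ≈M-setoid = record
    { Carrier       = M2
    ; _≈_           = _≈M_
    ; isEquivalence = record
      { refl  = refl , refl , refl , refl
      ; sym   = λ (p , q , r , s) → sym p , sym q , sym r , sym s
      ; trans = λ (p , q , r , s) (p′ , q′ , r′ , s′) → trans p p′ , trans q q′ , trans r r′ , trans s s′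
      }
    }

  module ≈M = Setoid ≈M-setoid

  ·-cong : ∀ {A A′ B B′} → A ≈M A′ → B ≈M B′ → A · B ≈M A′ · B′
  ·-cong (p , q , r , s) (p′ , q′ , r′ , s′) =
    +-cong (*-cong p p′) (*-cong q r′) , +-cong (*-cong p q′) (*-cong q s′) ,
    +-cong (*-cong r p′) (*-cong s r′) , +-cong (*-cong r q′) (*-cong s s′)

  •-cong : ∀ {u v A B} → u ≈ v → A ≈M B → u • A ≈M v • B
  •-cong u≈v (p , q , r , s) = *-cong u≈v p , *-cong u≈v q , *-cong u≈v r , *-cong u≈v s

  •-identity : ∀ {u} A → u ≈ 1# → u • A ≈M A
  •-identity {u} A u≈1 = scale (a A) , scale (b A) , scale (c' A) , scale (d A)
    where scale : ∀ x → u * x ≈ x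
          scale x = trans (*-congʳ u≈1) (*-identityˡ x)

  ⊕-cong : ∀ {A A′ B B′} → A ≈M A′ → B ≈M B′ → A ⊕ B ≈M A′ ⊕ B′
  ⊕-cong (p , q , r , s) (p′ , q′ , r′ , s′) = +-cong p p′ , +-cong q q′ , +-cong r r′ , +-cong s s′

  poly₁-cong : ∀ {s s′ t t′} Y → s ≈ s′ → t ≈ t′ → poly₁ s t Y ≈M poly₁ s′ t′ Y
  poly₁-cong Y s≈s′ t≈t′ = ⊕-cong (•-cong s≈s′ ≈M.refl) (•-cong t≈t′ ≈M.refl)

  drop-• : ∀ {A B C u} → u ≈ 0# → A ≈M B ⊕ u • C → A ≈M B
  drop-• {C = C} {u} u≈0 (p , q , r , s) = drop (a C) p , drop (b C) q , drop (c' C) r , drop (d C) s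
    where drop : ∀ {x y} z → x ≈ y + u * z → x ≈ y
          drop z x≈ = trans x≈ (trans (+-congˡ (trans (*-congʳ u≈0) (zeroˡ z))) (+-identityʳ _))

  drop-⊖ : ∀ {A B C D} → C ≈M D → A ≈M B ⊕ (C ⊖ D) → A ≈M B
  drop-⊖ (p′ , q′ , r′ , s′) (p , q , r , s) = drop p′ p , drop q′ q , drop r′ r , drop s′ s
    where drop : ∀ {x y u v} → u ≈ v → x ≈ y + (u - v) → x ≈ y
          drop u≈v x≈ = trans x≈ (trans (+-congˡ (x≈y⇒x∙y⁻¹≈ε u≈v)) (+-identityʳ _))

  -- Matrix identities are proved entrywise by the ring solver, in the polynomial ring whose
  -- 15 variables are the entries of three matrices followed by three scalars.
  record Symbolic : Set where
    constructor smat
    field sa sb sc sd : Polynomial 15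

  infixl 7 _·ₛ_
  infixl 6 _⊕ₛ_ _⊖ₛ_
  infixr 7 _•ₛ_

  _·ₛ_ : Symbolic → Symbolic → Symbolic
  smat a₁ b₁ c₁ d₁ ·ₛ smat a₂ b₂ c₂ d₂ =
    smat (a₁ :* a₂ :+ b₁ :* c₂) (a₁ :* b₂ :+ b₁ :* d₂) (c₁ :* a₂ :+ d₁ :* c₂) (c₁ :* b₂ :+ d₁ :* d₂)

  _⊕ₛ_ : Symbolic → Symbolic → Symbolic
  smat a₁ b₁ c₁ d₁ ⊕ₛ smat a₂ b₂ c₂ d₂ = smat (a₁ :+ a₂) (b₁ :+ b₂) (c₁ :+ c₂) (d₁ :+ d₂)

  _⊖ₛ_ : Symbolic → Symbolic → Symbolic
  smat a₁ b₁ c₁ d₁ ⊖ₛ smat a₂ b₂ c₂ d₂ = smat (a₁ :- a₂) (b₁ :- b₂) (c₁ :- c₂) (d₁ :- d₂)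

  _•ₛ_ : Polynomial 15 → Symbolic → Symbolic
  u •ₛ smat a₁ b₁ c₁ d₁ = smat (u :* a₁) (u :* b₁) (u :* c₁) (u :* d₁)

  invₛ : Symbolic → Symbolic
  invₛ (smat a₁ b₁ c₁ d₁) = smat d₁ (:- b₁) (:- c₁) a₁

  detₛ trₛ : Symbolic → Polynomial 15
  detₛ (smat a₁ b₁ c₁ d₁) = a₁ :* d₁ :- b₁ :* c₁
  trₛ (smat a₁ _ _ d₁) = a₁ :+ d₁

  𝕀ₛ : Symbolic
  𝕀ₛ = smat (con (+ 1)) (con (+ 0)) (con (+ 0)) (con (+ 1))

  poly₁ₛ : Polynomial 15 → Polynomial 15 → Symbolic → Symbolic
  poly₁ₛ s t Y = s •ₛ 𝕀ₛ ⊕ₛ t •ₛ Y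

  intertwinerₛ : Symbolic → Symbolic → Polynomial 15 → Symbolic
  intertwinerₛ W Y τ = W ⊕ₛ Y ⊕ₛ (:- τ) •ₛ 𝕀ₛ

  𝔸 𝔹 ℂ : Symbolic
  𝔸 = smat (var (# 0)) (var (# 1)) (var (# 2)) (var (# 3))
  𝔹 = smat (var (# 4)) (var (# 5)) (var (# 6)) (var (# 7))
  ℂ = smat (var (# 8)) (var (# 9)) (var (# 10)) (var (# 11))

  𝕤 𝕥 𝕦 : Polynomial 15
  𝕤 = var (# 12)
  𝕥 = var (# 13)
  𝕦 = var (# 14)

  env : M2 → M2 → M2 → Carrier → Carrier → Carrier → Vec Carrier 15
  env A B C s t u =
    a A ∷ b A ∷ c' A ∷ d A ∷ a B ∷ b B ∷ c' B ∷ d B ∷ a C ∷ b C ∷ c' C ∷ d C ∷ s ∷ t ∷ u ∷ []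

  ⟦_⟧ₘ : Symbolic → Vec Carrier 15 → M2
  ⟦ smat a₁ b₁ c₁ d₁ ⟧ₘ ρ = mat (⟦ a₁ ⟧ ρ) (⟦ b₁ ⟧ ρ) (⟦ c₁ ⟧ ρ) (⟦ d₁ ⟧ ρ)

  proveₘ : ∀ ρ L R → let open Symbolic in
           ⟦ sa L ⟧↓ ρ ≈ ⟦ sa R ⟧↓ ρ → ⟦ sb L ⟧↓ ρ ≈ ⟦ sb R ⟧↓ ρ →
           ⟦ sc L ⟧↓ ρ ≈ ⟦ sc R ⟧↓ ρ → ⟦ sd L ⟧↓ ρ ≈ ⟦ sd R ⟧↓ ρ →
           ⟦ L ⟧ₘ ρ ≈M ⟦ R ⟧ₘ ρ
  proveₘ ρ (smat a₁ b₁ c₁ d₁) (smat a₂ b₂ c₂ d₂) p q r s =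
    prove ρ a₁ a₂ p , prove ρ b₁ b₂ q , prove ρ c₁ c₂ r , prove ρ d₁ d₂ s

  ·-assoc : ∀ A B C → A · B · C ≈M A · (B · C)
  ·-assoc A B C = proveₘ (env A B C 0# 0# 0#) (𝔸 ·ₛ 𝔹 ·ₛ ℂ) (𝔸 ·ₛ (𝔹 ·ₛ ℂ)) refl refl refl refl

  det-· : ∀ A B → det (A · B) ≈ det A * det B
  det-· A B = prove (env A B A 0# 0# 0#) (detₛ (𝔸 ·ₛ 𝔹)) (detₛ 𝔸 :* detₛ 𝔹) refl

  poly₁-·-comm : ∀ s t Y → poly₁ s t Y · Y ≈M Y · poly₁ s t Y
  poly₁-·-comm s t Y = proveₘ (env Y Y Y s t 0#) (poly₁ₛ 𝕤 𝕥 𝔸 ·ₛ 𝔸) (𝔸 ·ₛ poly₁ₛ 𝕤 𝕥 𝔸) refl refl refl refl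

  •-poly₁ : ∀ u s t Y → u • poly₁ s t Y ≈M poly₁ (u * s) (u * t) Y
  •-poly₁ u s t Y = proveₘ (env Y Y Y s t u) (𝕦 •ₛ poly₁ₛ 𝕤 𝕥 𝔸) (poly₁ₛ (𝕦 :* 𝕤) (𝕦 :* 𝕥) 𝔸) refl refl refl refl

  det-poly₁ : ∀ s t Y → det (poly₁ s t Y) ≈ s * s + s * t * tr Y + t * t * det Y
  det-poly₁ s t Y = prove (env Y Y Y s t 0#) (detₛ (poly₁ₛ 𝕤 𝕥 𝔸)) (𝕤 :* 𝕤 :+ 𝕤 :* 𝕥 :* trₛ 𝔸 :+ 𝕥 :* 𝕥 :* detₛ 𝔸) refl

  cayley-hamilton-tr : ∀ A Y → tr (A · Y · Y) ≈ tr Y * tr (A · Y) - det Y * tr A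
  cayley-hamilton-tr A Y = prove (env A Y A 0# 0# 0#) (trₛ (𝔸 ·ₛ 𝔹 ·ₛ 𝔹)) (trₛ 𝔹 :* trₛ (𝔸 ·ₛ 𝔹) :- detₛ 𝔹 :* trₛ 𝔸) refl

  tr-·-poly₁ : ∀ A s t Y → tr (A · poly₁ s t Y) ≈ s * tr A + t * tr (A · Y)
  tr-·-poly₁ A s t Y = prove (env A Y A s t 0#) (trₛ (𝔸 ·ₛ poly₁ₛ 𝕤 𝕥 𝔹)) (𝕤 :* trₛ 𝔸 :+ 𝕥 :* trₛ (𝔸 ·ₛ 𝔹)) refl

  tr-·-poly₁-· : ∀ A s t Y → tr (A · poly₁ s t Y · Y) ≈ (s + t * tr Y) * tr (A · Y) - t * det Y * tr A
  tr-·-poly₁-· A s t Y =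
    prove (env A Y A s t 0#) (trₛ (𝔸 ·ₛ poly₁ₛ 𝕤 𝕥 𝔹 ·ₛ 𝔹))
      ((𝕤 :+ 𝕥 :* trₛ 𝔹) :* trₛ (𝔸 ·ₛ 𝔹) :- 𝕥 :* detₛ 𝔹 :* trₛ 𝔸) refl

  ·-·-·-inv-·-inv : ∀ A B C → A · B · C · inv C · inv B ≈M (det C * det B) • A
  ·-·-·-inv-·-inv A B C =
    proveₘ (env A B C 0# 0# 0#) (𝔸 ·ₛ 𝔹 ·ₛ ℂ ·ₛ invₛ ℂ ·ₛ invₛ 𝔹) ((detₛ ℂ :* detₛ 𝔹) •ₛ 𝔸) refl refl refl refl

  commutator-·-· : ∀ A B → A · B · inv A · inv B · B · A ≈M (det B * det A) • (A · B)
  commutator-·-· A B =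
    proveₘ (env A B A 0# 0# 0#) (𝔸 ·ₛ 𝔹 ·ₛ invₛ 𝔸 ·ₛ invₛ 𝔹 ·ₛ 𝔹 ·ₛ 𝔸) ((detₛ 𝔹 :* detₛ 𝔸) •ₛ (𝔸 ·ₛ 𝔹)) refl refl refl refl

  *-det-• : ∀ u A B → (u * det A) • B ≈M A · (u • (inv A · B))
  *-det-• u A B = proveₘ (env A B A u 0# 0#) ((𝕤 :* detₛ 𝔸) •ₛ 𝔹) (𝔸 ·ₛ (𝕤 •ₛ (invₛ 𝔸 ·ₛ 𝔹))) refl refl refl refl

  det-intertwiner : ∀ W Y τ →
    det (intertwiner W Y τ) ≈ det W + det Y + tr W * tr Y - tr (W · Y) - τ * (tr W + tr Y) + τ * τ
  det-intertwiner W Y τ =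
    prove (env W Y W τ 0# 0#) (detₛ (intertwinerₛ 𝔸 𝔹 𝕤))
      (detₛ 𝔸 :+ detₛ 𝔹 :+ trₛ 𝔸 :* trₛ 𝔹 :- trₛ (𝔸 ·ₛ 𝔹) :- 𝕤 :* (trₛ 𝔸 :+ trₛ 𝔹) :+ 𝕤 :* 𝕤) refl

  tr-intertwiner : ∀ W Y τ → tr (intertwiner W Y τ) ≈ tr W + tr Y - (τ + τ)
  tr-intertwiner W Y τ = prove (env W Y W τ 0# 0#) (trₛ (intertwinerₛ 𝔸 𝔹 𝕤)) (trₛ 𝔸 :+ trₛ 𝔹 :- (𝕤 :+ 𝕤)) refl

  tr-intertwiner-· : ∀ W Y τ →
    tr (intertwiner W Y τ · Y) ≈ tr (W · Y) + tr Y * tr Y - (det Y + det Y) - τ * tr Y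
  tr-intertwiner-· W Y τ =
    prove (env W Y W τ 0# 0#) (trₛ (intertwinerₛ 𝔸 𝔹 𝕤 ·ₛ 𝔹))
      (trₛ (𝔸 ·ₛ 𝔹) :+ trₛ 𝔹 :* trₛ 𝔹 :- (detₛ 𝔹 :+ detₛ 𝔹) :- 𝕤 :* trₛ 𝔹) refl

  intertwiner-· : ∀ W Y τ →
    intertwiner W Y τ · Y ≈M
      W · intertwiner W Y τ ⊕ (tr Y - τ) • Y ⊕ (τ - tr W) • W ⊕ (det W - det Y) • 𝕀
  intertwiner-· W Y τ =
    proveₘ (env W Y W τ 0# 0#) (intertwinerₛ 𝔸 𝔹 𝕤 ·ₛ 𝔹)
      (𝔸 ·ₛ intertwinerₛ 𝔸 𝔹 𝕤 ⊕ₛ (trₛ 𝔹 :- 𝕤) •ₛ 𝔹 ⊕ₛ (𝕤 :- trₛ 𝔸) •ₛ 𝔸 ⊕ₛ (detₛ 𝔸 :- detₛ 𝔹) •ₛ 𝕀ₛ)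
      refl refl refl refl

  inv-intertwiner-· : ∀ W Y τ P →
    inv (intertwiner W Y τ) · P ≈M
      poly₁ (tr Y * tr P - tr (P · Y)) (- tr P) Y ⊕ (tr W - τ) • P ⊕ (P · Y ⊖ W · P)
  inv-intertwiner-· W Y τ P =
    proveₘ (env W Y P τ 0# 0#) (invₛ (intertwinerₛ 𝔸 𝔹 𝕤) ·ₛ ℂ)
      (poly₁ₛ (trₛ 𝔹 :* trₛ ℂ :- trₛ (ℂ ·ₛ 𝔹)) (:- trₛ ℂ) 𝔹 ⊕ₛ (trₛ 𝔸 :- 𝕤) •ₛ ℂ ⊕ₛ (ℂ ·ₛ 𝔹 ⊖ₛ 𝔸 ·ₛ ℂ))
      refl refl refl refl

  ·-poly₁-intertwines : ∀ {A W Y} s t → A · Y ≈M W · A → A · poly₁ s t Y · Y ≈M W · (A · poly₁ s t Y)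
  ·-poly₁-intertwines {A} {W} {Y} s t AY≈WA = begin
    A · N · Y      ≈⟨ ·-assoc A N Y ⟩
    A · (N · Y)    ≈⟨ ·-cong ≈M.refl (poly₁-·-comm s t Y) ⟩
    A · (Y · N)    ≈⟨ ·-assoc A Y N ⟨
    A · Y · N      ≈⟨ ·-cong AY≈WA ≈M.refl ⟩
    W · A · N      ≈⟨ ·-assoc W A N ⟩
    W · (A · N)    ∎
    where
    open SetoidReasoning ≈M-setoid
    N : M2
    N = poly₁ s t Y

  module _ {X Y : M2} (detX≈1 : det X ≈ 1#) (detY≈1 : det Y ≈ 1#) where
    open SetoidReasoning ≈M-setoid

    intertwines⇒commutator≈ : ∀ {Z} → X · Y ≈M Z · Y · X → X · Y · inv X · inv Y ≈M Z
    intertwines⇒commutator≈ {Z} XY≈ZYX = begin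
      X · Y · inv X · inv Y          ≈⟨ ·-cong (·-cong XY≈ZYX ≈M.refl) ≈M.refl ⟩
      Z · Y · X · inv X · inv Y      ≈⟨ ·-·-·-inv-·-inv Z Y X ⟩
      (det X * det Y) • Z            ≈⟨ •-identity Z (trans (*-cong detX≈1 detY≈1) (*-identityˡ 1#)) ⟩
      Z                              ∎

    commutator≈⇒intertwines : ∀ {Z} → X · Y · inv X · inv Y ≈M Z → X · Y ≈M Z · Y · X
    commutator≈⇒intertwines {Z} [X,Y]≈Z = begin
      X · Y                          ≈⟨ •-identity (X · Y) (trans (*-cong detY≈1 detX≈1) (*-identityˡ 1#)) ⟨
      (det Y * det X) • (X · Y)      ≈⟨ commutator-·-· X Y ⟨
      X · Y · inv X · inv Y · Y · X  ≈⟨ ·-cong (·-cong [X,Y]≈Z ≈M.refl) ≈M.refl ⟩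
      Z · Y · X                      ∎

  module Intertwiner
    {W Y : M2} {τ t : Carrier}
    (detW≈1 : det W ≈ 1#) (detY≈1 : det Y ≈ 1#) (trW≈τ : tr W ≈ τ) (trY≈τ : tr Y ≈ τ)
    (trWY≈ττ-t : tr (W · Y) ≈ τ * τ - t)
    where

    open SetoidReasoning setoid

    Δ : Carrier
    Δ = t + (1# + 1#) - τ * τ

    X₀ : M2
    X₀ = intertwiner W Y τ

    det-X₀ : det X₀ ≈ Δ
    det-X₀ = begin
      det X₀
        ≈⟨ det-intertwiner W Y τ ⟩
      det W + det Y + tr W * tr Y - tr (W · Y) - τ * (tr W + tr Y) + τ * τ
        ≈⟨ +-congʳ (+-cong (+-cong (+-cong (+-cong detW≈1 detY≈1) (*-cong trW≈τ trY≈τ)) (-‿cong trWY≈ττ-t))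
                           (-‿cong (*-congˡ (+-cong trW≈τ trY≈τ)))) ⟩
      1# + 1# + τ * τ - (τ * τ - t) - τ * (τ + τ) + τ * τ
        ≈⟨ solve 2 (λ τ t → con (+ 1) :+ con (+ 1) :+ τ :* τ :- (τ :* τ :- t) :- τ :* (τ :+ τ) :+ τ :* τ
                            := t :+ con (+ 2) :- τ :* τ) refl τ t ⟩
      Δ ∎

    tr-X₀ : tr X₀ ≈ 0#
    tr-X₀ = begin
      tr X₀                  ≈⟨ tr-intertwiner W Y τ ⟩
      tr W + tr Y - (τ + τ)  ≈⟨ +-congʳ (+-cong trW≈τ trY≈τ) ⟩
      τ + τ - (τ + τ)        ≈⟨ -‿inverseʳ (τ + τ) ⟩
      0#                     ∎

    tr-X₀-· : tr (X₀ · Y) ≈ - Δ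
    tr-X₀-· = begin
      tr (X₀ · Y)
        ≈⟨ tr-intertwiner-· W Y τ ⟩
      tr (W · Y) + tr Y * tr Y - (det Y + det Y) - τ * tr Y
        ≈⟨ +-cong (+-cong (+-cong trWY≈ττ-t (*-cong trY≈τ trY≈τ)) (-‿cong (+-cong detY≈1 detY≈1)))
                  (-‿cong (*-congˡ trY≈τ)) ⟩
      τ * τ - t + τ * τ - (1# + 1#) - τ * τ
        ≈⟨ solve 2 (λ τ t → τ :* τ :- t :+ τ :* τ :- con (+ 2) :- τ :* τ := :- (t :+ con (+ 2) :- τ :* τ))
                   refl τ t ⟩
      - Δ ∎

    X₀-intertwines : X₀ · Y ≈M W · X₀
    X₀-intertwines =
      drop-• (x≈y⇒x∙y⁻¹≈ε trY≈τ) (drop-• (x≈y⇒x∙y⁻¹≈ε (sym trW≈τ))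
        (drop-• (x≈y⇒x∙y⁻¹≈ε (trans detW≈1 (sym detY≈1))) (intertwiner-· W Y τ)))

    inv-X₀-· : ∀ {P} → P · Y ≈M W · P → inv X₀ · P ≈M poly₁ (tr Y * tr P - tr (P · Y)) (- tr P) Y
    inv-X₀-· {P} PY≈WP = drop-• (x≈y⇒x∙y⁻¹≈ε trW≈τ) (drop-⊖ PY≈WP (inv-intertwiner-· W Y τ P))

  module Construction
    {Z Y : M2} {x₁ x₂ x₃ δ : Carrier}
    (detZ≈1 : det Z ≈ 1#) (detY≈1 : det Y ≈ 1#) (trZY≈x₂ : tr (Z · Y) ≈ x₂) (trY≈x₂ : tr Y ≈ x₂)
    (fricke : x₁ * x₁ + x₂ * x₂ + x₃ * x₃ - x₁ * x₂ * x₃ ≈ tr Z + (1# + 1#))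
    (Δδ≈1 : (tr Z + (1# + 1#) - x₂ * x₂) * δ ≈ 1#)
    where

    W : M2
    W = Z · Y

    det-W : det W ≈ 1#
    det-W = trans (det-· Z Y) (trans (*-cong detZ≈1 detY≈1) (*-identityʳ 1#))

    tr-W·Y : tr (W · Y) ≈ x₂ * x₂ - tr Z
    tr-W·Y = begin
      tr (Z · Y · Y)                       ≈⟨ cayley-hamilton-tr Z Y ⟩
      tr Y * tr (Z · Y) - det Y * tr Z     ≈⟨ +-cong (*-cong trY≈x₂ trZY≈x₂) (-‿cong (*-congʳ detY≈1)) ⟩
      x₂ * x₂ - 1# * tr Z                  ≈⟨ +-congˡ (-‿cong (*-identityˡ (tr Z))) ⟩
      x₂ * x₂ - tr Z                       ∎
      where
      open SetoidReasoning setoid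

    open Intertwiner det-W detY≈1 trZY≈x₂ trY≈x₂ tr-W·Y

    -- solved from tr X = − β Δ = x₁ and tr (X Y) = − (α + β x₂) Δ = x₃
    α β : Carrier
    α = δ * (x₂ * x₁ - x₃)
    β = δ * (- x₁)

    X : M2
    X = X₀ · poly₁ α β Y

    det-X : det X ≈ 1#
    det-X = begin
      det X
        ≈⟨ det-· X₀ (poly₁ α β Y) ⟩
      det X₀ * det (poly₁ α β Y)
        ≈⟨ *-congˡ (det-poly₁ α β Y) ⟩
      det X₀ * (α * α + α * β * tr Y + β * β * det Y)
        ≈⟨ *-cong det-X₀ (+-cong (+-congˡ (*-congˡ trY≈x₂)) (*-congˡ detY≈1)) ⟩
      Δ * (α * α + α * β * x₂ + β * β * 1#)
        ≈⟨ solve 5 (λ t x₁ x₂ x₃ δ →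
             let Δ = t :+ con (+ 2) :- x₂ :* x₂; α = δ :* (x₂ :* x₁ :- x₃); β = δ :* (:- x₁) in
             Δ :* (α :* α :+ α :* β :* x₂ :+ β :* β :* con (+ 1))
             := (Δ :* δ) :* (δ :* (x₁ :* x₁ :+ x₂ :* x₂ :+ x₃ :* x₃ :- x₁ :* x₂ :* x₃ :- x₂ :* x₂)))
             refl (tr Z) x₁ x₂ x₃ δ ⟩
      (Δ * δ) * (δ * (x₁ * x₁ + x₂ * x₂ + x₃ * x₃ - x₁ * x₂ * x₃ - x₂ * x₂))
        ≈⟨ *-congˡ (*-congˡ (+-congʳ fricke)) ⟩
      (Δ * δ) * (δ * Δ)
        ≈⟨ *-cong Δδ≈1 (trans (*-comm δ Δ) Δδ≈1) ⟩
      1# * 1#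
        ≈⟨ *-identityˡ 1# ⟩
      1# ∎
      where
      open SetoidReasoning setoid

    tr-X : tr X ≈ x₁
    tr-X = begin
      tr X                                ≈⟨ tr-·-poly₁ X₀ α β Y ⟩
      α * tr X₀ + β * tr (X₀ · Y)         ≈⟨ +-cong (*-congˡ tr-X₀) (*-congˡ tr-X₀-·) ⟩
      α * 0# + β * - Δ                    ≈⟨ solve 5 (λ t x₁ x₂ x₃ δ →
                                               let Δ = t :+ con (+ 2) :- x₂ :* x₂ in
                                               δ :* (x₂ :* x₁ :- x₃) :* con (+ 0) :+ δ :* (:- x₁) :* :- Δ
                                               := x₁ :* (Δ :* δ))
                                               refl (tr Z) x₁ x₂ x₃ δ ⟩
      x₁ * (Δ * δ)                        ≈⟨ *-congˡ Δδ≈1 ⟩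
      x₁ * 1#                             ≈⟨ *-identityʳ x₁ ⟩
      x₁                                  ∎
      where
      open SetoidReasoning setoid

    tr-X·Y : tr (X · Y) ≈ x₃
    tr-X·Y = begin
      tr (X · Y)
        ≈⟨ tr-·-poly₁-· X₀ α β Y ⟩
      (α + β * tr Y) * tr (X₀ · Y) - β * det Y * tr X₀
        ≈⟨ +-cong (*-cong (+-congˡ (*-congˡ trY≈x₂)) tr-X₀-·) (-‿cong (*-cong (*-congˡ detY≈1) tr-X₀)) ⟩
      (α + β * x₂) * - Δ - β * 1# * 0#
        ≈⟨ solve 5 (λ t x₁ x₂ x₃ δ →
             let Δ = t :+ con (+ 2) :- x₂ :* x₂; α = δ :* (x₂ :* x₁ :- x₃); β = δ :* (:- x₁) in
             (α :+ β :* x₂) :* :- Δ :- β :* con (+ 1) :* con (+ 0) := x₃ :* (Δ :* δ))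
             refl (tr Z) x₁ x₂ x₃ δ ⟩
      x₃ * (Δ * δ)
        ≈⟨ *-congˡ Δδ≈1 ⟩
      x₃ * 1#
        ≈⟨ *-identityʳ x₃ ⟩
      x₃ ∎
      where
      open SetoidReasoning setoid

    X-commutator : X · Y · inv X · inv Y ≈M Z
    X-commutator = intertwines⇒commutator≈ det-X detY≈1 (·-poly₁-intertwines α β X₀-intertwines)

    X-unique : (P : M2) → InSL2 P → tr P ≈ x₁ → tr (P · Y) ≈ x₃ → P · Y · inv P · inv Y ≈M Z → P ≈M X
    X-unique P detP≈1 trP≈x₁ trPY≈x₃ [P,Y]≈Z = begin
      P                                                      ≈⟨ •-identity P δdetX₀≈1 ⟨
      (δ * det X₀) • P                                       ≈⟨ *-det-• δ X₀ P ⟩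
      X₀ · (δ • (inv X₀ · P))                                ≈⟨ ·-cong ≈M.refl (•-cong refl (inv-X₀-· PY≈WP)) ⟩
      X₀ · (δ • poly₁ (tr Y * tr P - tr (P · Y)) (- tr P) Y) ≈⟨ ·-cong ≈M.refl (•-poly₁ δ _ _ Y) ⟩
      X₀ · poly₁ (δ * (tr Y * tr P - tr (P · Y))) (δ * - tr P) Y
        ≈⟨ ·-cong ≈M.refl (poly₁-cong Y (*-congˡ (+-cong (*-cong trY≈x₂ trP≈x₁) (-‿cong trPY≈x₃)))
                                         (*-congˡ (-‿cong trP≈x₁))) ⟩
      X                                                      ∎
      where
      open SetoidReasoning ≈M-setoid
      PY≈WP : P · Y ≈M W · P
      PY≈WP = commutator≈⇒intertwines detP≈1 detY≈1 [P,Y]≈Z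
      δdetX₀≈1 : δ * det X₀ ≈ 1#
      δdetX₀≈1 = trans (*-congˡ det-X₀) (trans (*-comm δ Δ) Δδ≈1)

unique-commutator-solution : ∀ {c ℓ} (R : CommutativeRing c ℓ) →
  let open CommutativeRing R; open Mat2 R in
  ∀ {Z : M2} {x₁ x₂ x₃ : Carrier} → InSL2 Z →
  x₁ * x₁ + x₂ * x₂ + x₃ * x₃ - x₁ * x₂ * x₃ ≈ tr Z + (1# + 1#) →
  IsUnit R (tr Z + (1# + 1#) - x₂ * x₂) →
  (Y : M2) → InSL2 Y → tr (Z · Y) ≈ x₂ → tr Y ≈ x₂ →
  Σ M2 (λ X → (InSL2 X × tr X ≈ x₁ × tr (X · Y) ≈ x₃ × X · Y · inv X · inv Y ≈M Z)
    × ((X′ : M2) → InSL2 X′ → tr X′ ≈ x₁ → tr (X′ · Y) ≈ x₃ → X′ · Y · inv X′ · inv Y ≈M Z → X′ ≈M X))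
unique-commutator-solution R detZ≈1 fricke (δ , Δδ≈1) Y detY≈1 trZY≈x₂ trY≈x₂ =
  X , (det-X , tr-X , tr-X·Y , X-commutator) , X-unique
  where
  open Matrices.Construction R detZ≈1 detY≈1 trZY≈x₂ trY≈x₂ fricke Δδ≈1

lemma3p5 : ∀ {c ℓ} →
  -- field version
  ((F : CommutativeRing c ℓ) → IsField F → CharZero F →
    let open CommutativeRing F in let open Mat2 F in
    (Z : M2) → InSL2 Z → ¬ (tr Z ≈ 1# + 1#) → ¬ (tr Z ≈ - (1# + 1#)) →
    (x₁ x₂ x₃ : Carrier) →
    x₁ * x₁ + x₂ * x₂ + x₃ * x₃ - x₁ * x₂ * x₃ ≈ tr Z + (1# + 1#) →
    ¬ (tr Z + (1# + 1#) - x₂ * x₂ ≈ 0#) →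
    (Y : M2) → InSL2 Y → tr (Z · Y) ≈ x₂ → tr Y ≈ x₂ →
    Σ M2 (λ X → (InSL2 X × tr X ≈ x₁ × tr (X · Y) ≈ x₃ × X · Y · inv X · inv Y ≈M Z)
      × ((X′ : M2) → InSL2 X′ → tr X′ ≈ x₁ → tr (X′ · Y) ≈ x₃ → X′ · Y · inv X′ · inv Y ≈M Z → X′ ≈M X)))
  ×
  -- commutative ring version
  ((D : CommutativeRing c ℓ) →
    let open CommutativeRing D in let open Mat2 D in
    (Z : M2) → InSL2 Z → ¬ (tr Z ≈ 1# + 1#) → ¬ (tr Z ≈ - (1# + 1#)) →
    (x₁ x₂ x₃ : Carrier) →
    x₁ * x₁ + x₂ * x₂ + x₃ * x₃ - x₁ * x₂ * x₃ ≈ tr Z + (1# + 1#) →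
    IsUnit D (tr Z + (1# + 1#) - x₂ * x₂) →
    (Y : M2) → InSL2 Y → tr (Z · Y) ≈ x₂ → tr Y ≈ x₂ →
    Σ M2 (λ X → (InSL2 X × tr X ≈ x₁ × tr (X · Y) ≈ x₃ × X · Y · inv X · inv Y ≈M Z)
      × ((X′ : M2) → InSL2 X′ → tr X′ ≈ x₁ → tr (X′ · Y) ≈ x₃ → X′ · Y · inv X′ · inv Y ≈M Z → X′ ≈M X)))
lemma3p5 =
  (λ F (_ , inverse) _ _ detZ≈1 _ _ _ _ _ fricke Δ≉0 →
     unique-commutator-solution F detZ≈1 fricke (inverse _ Δ≉0))
  , (λ D _ detZ≈1 _ _ _ _ _ fricke Δ-unit → unique-commutator-solution D detZ≈1 fricke Δ-unit)
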